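{- Let $I=(p_t)_{t\in[T]}$ be an instance and $X=\{x_1<\dots<x_k\}$ a feasible solution for $I$. With $x_0=0$, let $S_i=\{t: x_{i-1}<t\le x_i\}$ and $I_i=(p_t)_{t\in S_i}$ for $i\in[k]$. Then $$\sum_{i\in[k]}\mathrm{OPT}(I_i)\le k-1+\mathrm{OPT}(I).$$
   Context: Dynamic acknowledgment problem. Fix $d>0$. An instance is a sequence $I=(p_t)$ of nonnegative numbers indexed by consecutive time steps ($p_t$ requests at time $t$). A solution is a set $X=\{x_1<\dots<x_k\}$ of acknowledgment times within the instance's time range, feasible if $x_k\ge$ the last time with $p_t>0$. With $x_0$ the time preceding the first time step, its cost is $F(I,X)=|X|+\frac1d\sum_{i=1}^{k}\sum_{t=x_{i-1}+1}^{x_i}p_t(x_i-t)$. $\mathrm{OPT}(I)$ is the minimum cost of a feasible solution.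
   Formalization: The request amounts $p_t$ and the parameter $d$ are taken over the rationals. -}

module Defs where

open import Data.Nat as ℕ using (ℕ; zero; suc; _∸_)
open import Data.Integer using (+_)
open import Data.Rational using (ℚ; 0ℚ; _+_; _*_; _÷_; _⊓_; _/_; NonZero; Positive)
open import Data.Rational.Properties using (_<?_; pos⇒nonZero)
open import Data.List using (List; []; _∷_; length; map; foldr; filterᵇ; applyUpTo; take; drop; _++_)
open import Data.Bool using (Bool; true; false; not; _∧_)
open import Relation.Nullary.Decidable using (⌊_⌋)

-- An instance I = (p_1, …, p_T) is the list of request amounts; T = length I.
Instance : Set
Instance = List ℚ

-- A solution is the list x_1 < … < x_k of acknowledgment times (times are 1,…,T).
Solution : Set
Solution = List ℕ

ℕtoℚ : ℕ → ℚ
ℕtoℚ n = + n / 1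

-- p I t = p_t for 1 ≤ t ≤ T (0 outside this range)
pAt : Instance → ℕ → ℚ
pAt []       _             = 0ℚ
pAt (q ∷ _)  zero          = 0ℚ
pAt (q ∷ _)  (suc zero)    = q
pAt (_ ∷ qs) (suc (suc n)) = pAt qs (suc n)

sumℚ : List ℚ → ℚ
sumℚ = foldr _+_ 0ℚ

-- sumRange f a b = Σ_{t = a+1}^{b} f t
sumRange : (ℕ → ℚ) → ℕ → ℕ → ℚ
sumRange f a b = sumℚ (map (λ j → f (ℕ._+_ a (suc j))) (applyUpTo (λ j → j) (b ∸ a)))

-- waiting part: Σ_{i=1}^{k} Σ_{t=x_{i-1}+1}^{x_i} p_t (x_i − t), started with x_0 = prev
waiting : Instance → ℕ → Solution → ℚ
waiting I prev []       = 0ℚ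
waiting I prev (x ∷ xs) =
  sumRange (λ t → pAt I t * ℕtoℚ (x ∸ t)) prev x + waiting I x xs

cost : (d : ℚ) → .{{Positive d}} → Instance → Solution → ℚ
cost d {{pd}} I X = ℕtoℚ (length X) + (waiting I 0 X ÷ d) {{pos⇒nonZero d {{pd}}}}

lastTime : Solution → ℕ
lastTime []           = 0
lastTime (x ∷ [])     = x
lastTime (_ ∷ y ∷ ys) = lastTime (y ∷ ys)

subsetsFrom : ℕ → ℕ → List Solution
subsetsFrom a zero    = [] ∷ []
subsetsFrom a (suc n) = map (a ∷_) (subsetsFrom (suc a) n) ++ subsetsFrom (suc a) n

isNonEmpty : Solution → Bool
isNonEmpty []      = false
isNonEmpty (_ ∷ _) = true

allᵇ : {A : Set} → (A → Bool) → List A → Bool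
allᵇ P []       = true
allᵇ P (x ∷ xs) = P x ∧ allᵇ P xs

-- Boolean feasibility of a (sorted, in-range) candidate: X nonempty and no
-- time t > x_k has p_t > 0.
feasibleᵇ : Instance → Solution → Bool
feasibleᵇ I X = isNonEmpty X ∧ allᵇ (λ q → not ⌊ 0ℚ <? q ⌋) (drop (lastTime X) I)

fullSolution : Instance → Solution
fullSolution I = applyUpTo suc (length I)

-- OPT(I): minimum cost over all feasible solutions X ⊆ {1,…,T}
-- (the full solution, which is feasible whenever T ≥ 1, seeds the minimum)
OPT : (d : ℚ) → .{{Positive d}} → Instance → ℚ
OPT d I = foldr _⊓_ (cost d I (fullSolution I))
                (map (cost d I) (filterᵇ (feasibleᵇ I) (subsetsFrom 1 (length I))))

-- The sub-instances I_i = (p_t)_{x_{i-1} < t ≤ x_i}, re-indexed from 1, with x_0 = prev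
segments : Instance → ℕ → Solution → List Instance
segments I prev []       = []
segments I prev (x ∷ xs) = take (x ∸ prev) (drop prev I) ∷ segments I x xs

-- Let Y be an optimal solution of I. On a segment S_i = (x_{i-1}, x_i], acknowledging at the times
-- of Y inside S_i and additionally at x_i is feasible for I_i, and no request waits longer than under Y,
-- because x_i comes no later than the next time of Y. So OPT(I_i) is at most |Y ∩ S_i| + 1 plus the
-- waiting cost Y pays on S_i, and these bounds add up to |Y| + k + waiting(Y)/d = OPT(I) + k. One unit
-- is saved: either Y has a time after x_k, counted in |Y| but in no segment, or the segment holding the
-- last time of Y needs no extra acknowledgment, since Y leaves no positive request after that time.
module Submission where

open import Defs
open import Data.Nat using (ℕ; _<_; _≤_)
open import Data.Rational using (ℚ; 0ℚ; 1ℚ; _+_; _-_; Positive) renaming (_≤_ to _≤ℚ_; _<_ to _<ℚ_)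
open import Data.List using (List; []; _∷_; length; map)
open import Data.List.Relation.Unary.All using (All)
open import Data.List.Relation.Unary.Linked using (Linked)
open import Relation.Binary.PropositionalEquality using (_≢_)
open import Data.Product using (_×_)

open import Data.Bool using (Bool; not; T)
open import Data.Bool.Properties using (T-∧)
open import Data.Empty using (⊥-elim)
import Data.Integer as ℤ
import Data.Integer.Properties as ℤ
open import Data.List using (_++_; take; drop; foldr; applyUpTo; filterᵇ)
import Data.List.Properties as List
open import Data.List.Membership.Propositional using (_∈_)
open import Data.List.Membership.Propositional.Properties
  using (∈-map⁺; ∈-map⁻; ∈-++⁺ˡ; ∈-++⁺ʳ; ∈-++⁻; ∈-filter⁺; ∈-filter⁻; foldr-selective)
open import Data.List.Relation.Unary.All as All using ([]; _∷_)
import Data.List.Relation.Unary.Any as Any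
open import Data.List.Relation.Unary.Any using (here)
open import Data.List.Relation.Unary.Linked as Linked using ([-])
open import Data.Nat as ℕ using (zero; suc; _∸_; z≤n; s≤s)
import Data.Nat.Properties as ℕ
open import Data.Product using (_,_; proj₁; proj₂; uncurry; ∃-syntax)
open import Data.Rational as ℚ using (_÷_)
import Data.Rational.Properties as ℚ
open import Data.Rational.Solver using (module +-*-Solver)
open import Data.Nat.Tactic.RingSolver using (solve-∀)
import Data.Rational.Unnormalised as ℚᵘ
import Data.Rational.Unnormalised.Properties as ℚᵘ
open import Data.Sum using (_⊎_; inj₁; inj₂; [_,_])
open import Function using (_∘_; Equivalence)
open import Relation.Binary.PropositionalEquality
  using (_≡_; refl; sym; trans; cong; cong₂; subst; subst₂; module ≡-Reasoning)
open import Relation.Nullary using (¬_; yes; no)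
open import Relation.Nullary.Decidable using (⌊_⌋; T?)

module _ where
  open import Data.Integer using (+_)

  -- ℕtoℚ n is definitionally fromℚᵘ (mkℚᵘ (+ n) 0), so the sum can be computed in ℚᵘ.
  ℕtoℚ-+ : ∀ m n → ℕtoℚ (m ℕ.+ n) ≡ ℕtoℚ m + ℕtoℚ n
  ℕtoℚ-+ m n = ℚ.toℚᵘ-injective (begin
      ℚ.toℚᵘ (ℕtoℚ (m ℕ.+ n))                ≈⟨ ℚ.toℚᵘ-fromℚᵘ (embed (m ℕ.+ n)) ⟩
      embed (m ℕ.+ n)                        ≈⟨ ℚᵘ.*≡* numerators ⟩
      embed m ℚᵘ.+ embed n                   ≈⟨ ℚᵘ.+-cong (ℚᵘ.≃-sym (ℚ.toℚᵘ-fromℚᵘ (embed m)))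
                                                         (ℚᵘ.≃-sym (ℚ.toℚᵘ-fromℚᵘ (embed n))) ⟩
      ℚ.toℚᵘ (ℕtoℚ m) ℚᵘ.+ ℚ.toℚᵘ (ℕtoℚ n)   ≈⟨ ℚᵘ.≃-sym (ℚ.toℚᵘ-homo-+ (ℕtoℚ m) (ℕtoℚ n)) ⟩
      ℚ.toℚᵘ (ℕtoℚ m + ℕtoℚ n)               ∎)
    where
    open ℚᵘ.≃-Reasoning
    embed : ℕ → ℚᵘ.ℚᵘ
    embed k = ℚᵘ.mkℚᵘ (+ k) 0
    numerators : + (m ℕ.+ n) ℤ.* + 1 ≡ (+ m ℤ.* + 1 ℤ.+ + n ℤ.* + 1) ℤ.* + 1
    numerators = trans (ℤ.*-identityʳ (+ (m ℕ.+ n)))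
      (sym (trans (ℤ.*-identityʳ (+ m ℤ.* + 1 ℤ.+ + n ℤ.* + 1))
                  (cong₂ ℤ._+_ (ℤ.*-identityʳ (+ m)) (ℤ.*-identityʳ (+ n)))))

0≤ℕtoℚ : ∀ n → 0ℚ ≤ℚ ℕtoℚ n
0≤ℕtoℚ n = ℚ.nonNegative⁻¹ (ℕtoℚ n) {{ℚ.normalize-nonNeg n 1}}

ℕtoℚ-mono-≤ : ∀ {m n} → m ≤ n → ℕtoℚ m ≤ℚ ℕtoℚ n
ℕtoℚ-mono-≤ {m} {n} m≤n = begin
    ℕtoℚ m                 ≡⟨ ℚ.+-identityʳ (ℕtoℚ m) ⟨
    ℕtoℚ m + 0ℚ            ≤⟨ ℚ.+-monoʳ-≤ (ℕtoℚ m) (0≤ℕtoℚ (n ∸ m)) ⟩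
    ℕtoℚ m + ℕtoℚ (n ∸ m)  ≡⟨ ℕtoℚ-+ m (n ∸ m) ⟨
    ℕtoℚ (m ℕ.+ (n ∸ m))   ≡⟨ cong ℕtoℚ (ℕ.m+[n∸m]≡n m≤n) ⟩
    ℕtoℚ n                 ∎
  where open ℚ.≤-Reasoning

1+p≤q+r⇒p≤q-1+r : ∀ p q r → 1ℚ + p ≤ℚ q + r → p ≤ℚ (q - 1ℚ) + r
1+p≤q+r⇒p≤q-1+r p q r 1+p≤q+r = begin
    p                         ≡⟨ solve 1 (λ p → p := (con 1ℚ :+ p) :- con 1ℚ) refl p ⟩
    (1ℚ + p) - 1ℚ             ≤⟨ ℚ.+-monoˡ-≤ (ℚ.- 1ℚ) 1+p≤q+r ⟩
    (q + r) - 1ℚ              ≡⟨ solve 2 (λ q r → (q :+ r) :- con 1ℚ := (q :- con 1ℚ) :+ r) refl q r ⟩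
    (q - 1ℚ) + r              ∎
  where
  open ℚ.≤-Reasoning
  open +-*-Solver

sumTo : (ℕ → ℚ) → ℕ → ℚ
sumTo f zero    = 0ℚ
sumTo f (suc n) = f 0 + sumTo (f ∘ suc) n

sumℚ-map-applyUpTo : ∀ (g : ℕ → ℚ) h n → sumℚ (map g (applyUpTo h n)) ≡ sumTo (g ∘ h) n
sumℚ-map-applyUpTo g h zero    = refl
sumℚ-map-applyUpTo g h (suc n) = cong (g (h 0) +_) (sumℚ-map-applyUpTo g (h ∘ suc) n)

sumTo-cong : ∀ {f g} n → (∀ j → j < n → f j ≡ g j) → sumTo f n ≡ sumTo g n
sumTo-cong zero    f≡g = refl
sumTo-cong (suc n) f≡g =
  cong₂ _+_ (f≡g 0 (s≤s z≤n)) (sumTo-cong n (λ j j<n → f≡g (suc j) (s≤s j<n)))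

sumTo-mono-≤ : ∀ {f g} n → (∀ j → j < n → f j ≤ℚ g j) → sumTo f n ≤ℚ sumTo g n
sumTo-mono-≤ zero    f≤g = ℚ.≤-refl
sumTo-mono-≤ (suc n) f≤g =
  ℚ.+-mono-≤ (f≤g 0 (s≤s z≤n)) (sumTo-mono-≤ n (λ j j<n → f≤g (suc j) (s≤s j<n)))

sumTo-+ : ∀ f m n → sumTo f (m ℕ.+ n) ≡ sumTo f m + sumTo (λ j → f (m ℕ.+ j)) n
sumTo-+ f zero    n = sym (ℚ.+-identityˡ _)
sumTo-+ f (suc m) n = trans (cong (f 0 +_) (sumTo-+ (f ∘ suc) m n))
  (sym (ℚ.+-assoc (f 0) (sumTo (f ∘ suc) m) (sumTo (λ j → f (suc m ℕ.+ j)) n)))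

sumTo-zero : ∀ n → sumTo (λ _ → 0ℚ) n ≡ 0ℚ
sumTo-zero zero    = refl
sumTo-zero (suc n) = cong (0ℚ +_) (sumTo-zero n)

sumRange≡sumTo : ∀ f a b → sumRange f a b ≡ sumTo (λ j → f (a ℕ.+ suc j)) (b ∸ a)
sumRange≡sumTo f a b = sumℚ-map-applyUpTo (λ j → f (a ℕ.+ suc j)) (λ j → j) (b ∸ a)

+-suc-inRange : ∀ {a b j} → j < b ∸ a → a < a ℕ.+ suc j × a ℕ.+ suc j ≤ b
+-suc-inRange {a} {b} j<b∸a with ℕ.≤-total a b
... | inj₁ a≤b = ℕ.m<m+n a (s≤s z≤n) , ℕ.≤-trans (ℕ.+-monoʳ-≤ a j<b∸a) (ℕ.≤-reflexive (ℕ.m+[n∸m]≡n a≤b))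
... | inj₂ b≤a rewrite ℕ.m≤n⇒m∸n≡0 b≤a with () ← j<b∸a

module _ {f g : ℕ → ℚ} (a b : ℕ) where

  sumRange-cong : (∀ t → a < t → t ≤ b → f t ≡ g t) → sumRange f a b ≡ sumRange g a b
  sumRange-cong f≡g = begin
      sumRange f a b                          ≡⟨ sumRange≡sumTo f a b ⟩
      sumTo (λ j → f (a ℕ.+ suc j)) (b ∸ a)   ≡⟨ sumTo-cong (b ∸ a) (λ j j< → uncurry (f≡g _) (+-suc-inRange j<)) ⟩
      sumTo (λ j → g (a ℕ.+ suc j)) (b ∸ a)   ≡⟨ sumRange≡sumTo g a b ⟨
      sumRange g a b                          ∎
    where open ≡-Reasoning

  sumRange-mono-≤ : (∀ t → a < t → t ≤ b → f t ≤ℚ g t) → sumRange f a b ≤ℚ sumRange g a b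
  sumRange-mono-≤ f≤g = begin
      sumRange f a b                          ≡⟨ sumRange≡sumTo f a b ⟩
      sumTo (λ j → f (a ℕ.+ suc j)) (b ∸ a)   ≤⟨ sumTo-mono-≤ (b ∸ a) (λ j j< → uncurry (f≤g _) (+-suc-inRange j<)) ⟩
      sumTo (λ j → g (a ℕ.+ suc j)) (b ∸ a)   ≡⟨ sumRange≡sumTo g a b ⟨
      sumRange g a b                          ∎
    where open ℚ.≤-Reasoning

sumRange-const-0 : ∀ a b → sumRange (λ _ → 0ℚ) a b ≡ 0ℚ
sumRange-const-0 a b = trans (sumRange≡sumTo (λ _ → 0ℚ) a b) (sumTo-zero (b ∸ a))

sumRange-nonNeg : ∀ {f} a b → (∀ t → a < t → t ≤ b → 0ℚ ≤ℚ f t) → 0ℚ ≤ℚ sumRange f a b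
sumRange-nonNeg {f} a b 0≤f =
  subst (_≤ℚ sumRange f a b) (sumRange-const-0 a b) (sumRange-mono-≤ a b 0≤f)

sumRange-nonPos : ∀ {f} a b → (∀ t → a < t → t ≤ b → f t ≤ℚ 0ℚ) → sumRange f a b ≤ℚ 0ℚ
sumRange-nonPos {f} a b f≤0 =
  subst (sumRange f a b ≤ℚ_) (sumRange-const-0 a b) (sumRange-mono-≤ a b f≤0)

sumRange-split : ∀ f {a m b} → a ≤ m → m ≤ b → sumRange f a b ≡ sumRange f a m + sumRange f m b
sumRange-split f {a} {m} {b} a≤m m≤b = begin
    sumRange f a b                                              ≡⟨ sumRange≡sumTo f a b ⟩
    sumTo F (b ∸ a)                                             ≡⟨ cong (sumTo F) b∸a ⟩
    sumTo F ((m ∸ a) ℕ.+ (b ∸ m))                               ≡⟨ sumTo-+ F (m ∸ a) (b ∸ m) ⟩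
    sumTo F (m ∸ a) + sumTo (λ j → F ((m ∸ a) ℕ.+ j)) (b ∸ m)   ≡⟨ cong₂ _+_ (sumRange≡sumTo f a m) tail ⟨
    sumRange f a m + sumRange f m b                             ∎
  where
  open ≡-Reasoning
  F : ℕ → ℚ
  F j = f (a ℕ.+ suc j)
  b∸a : b ∸ a ≡ (m ∸ a) ℕ.+ (b ∸ m)
  b∸a = begin
    b ∸ a                       ≡⟨ cong (_∸ a) (ℕ.m∸n+n≡m (ℕ.≤-trans a≤m m≤b)) ⟨
    (b ∸ a) ℕ.+ a ∸ a           ≡⟨ ℕ.m+n∸n≡m (b ∸ a) a ⟩
    b ∸ a                       ≡⟨ cong (_∸ a) (ℕ.m∸n+n≡m m≤b) ⟨
    (b ∸ m) ℕ.+ m ∸ a           ≡⟨ ℕ.+-∸-assoc (b ∸ m) a≤m ⟩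
    (b ∸ m) ℕ.+ (m ∸ a)         ≡⟨ ℕ.+-comm (b ∸ m) (m ∸ a) ⟩
    (m ∸ a) ℕ.+ (b ∸ m)         ∎
  index : ∀ j → m ℕ.+ suc j ≡ a ℕ.+ suc ((m ∸ a) ℕ.+ j)
  index j = begin
    m ℕ.+ suc j                 ≡⟨ cong (ℕ._+ suc j) (ℕ.m+[n∸m]≡n a≤m) ⟨
    a ℕ.+ (m ∸ a) ℕ.+ suc j     ≡⟨ ℕ.+-assoc a (m ∸ a) (suc j) ⟩
    a ℕ.+ ((m ∸ a) ℕ.+ suc j)   ≡⟨ cong (a ℕ.+_) (ℕ.+-suc (m ∸ a) j) ⟩
    a ℕ.+ suc ((m ∸ a) ℕ.+ j)   ∎
  tail : sumRange f m b ≡ sumTo (λ j → F ((m ∸ a) ℕ.+ j)) (b ∸ m)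
  tail = trans (sumRange≡sumTo f m b) (sumTo-cong (b ∸ m) (λ j _ → cong f (index j)))

sumRange-shift : ∀ f k a b → sumRange f (k ℕ.+ a) (k ℕ.+ b) ≡ sumRange (λ t → f (k ℕ.+ t)) a b
sumRange-shift f k a b = begin
    sumRange f (k ℕ.+ a) (k ℕ.+ b)
      ≡⟨ sumRange≡sumTo f (k ℕ.+ a) (k ℕ.+ b) ⟩
    sumTo (λ j → f (k ℕ.+ a ℕ.+ suc j)) ((k ℕ.+ b) ∸ (k ℕ.+ a))
      ≡⟨ cong (sumTo _) (ℕ.[m+n]∸[m+o]≡n∸o k b a) ⟩
    sumTo (λ j → f (k ℕ.+ a ℕ.+ suc j)) (b ∸ a)
      ≡⟨ sumTo-cong (b ∸ a) (λ j _ → cong f (ℕ.+-assoc k a (suc j))) ⟩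
    sumTo (λ j → f (k ℕ.+ (a ℕ.+ suc j))) (b ∸ a)
      ≡⟨ sumRange≡sumTo (λ t → f (k ℕ.+ t)) a b ⟨
    sumRange (λ t → f (k ℕ.+ t)) a b
      ∎
  where open ≡-Reasoning

-- Strictly increasing lists of times

data Ascending : ℕ → List ℕ → Set where
  []  : ∀ {a} → Ascending a []
  _∷_ : ∀ {a y ys} → a < y → Ascending y ys → Ascending a (y ∷ ys)

lastOr : ℕ → List ℕ → ℕ
lastOr a []       = a
lastOr a (y ∷ ys) = lastOr y ys

Ascending-weaken : ∀ {a b Y} → b ≤ a → Ascending a Y → Ascending b Y
Ascending-weaken b≤a []         = []
Ascending-weaken b≤a (a<y ∷ Y↑) = ℕ.≤-<-trans b≤a a<y ∷ Y↑

lastOr-≥ : ∀ {a Y} → Ascending a Y → a ≤ lastOr a Y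
lastOr-≥ []         = ℕ.≤-refl
lastOr-≥ (a<y ∷ Y↑) = ℕ.≤-trans (ℕ.<⇒≤ a<y) (lastOr-≥ Y↑)

lastOr-++ : ∀ a L R → lastOr a (L ++ R) ≡ lastOr (lastOr a L) R
lastOr-++ a []      R = refl
lastOr-++ a (y ∷ L) R = lastOr-++ y L R

lastOr-∷ʳ : ∀ a L x → lastOr a (L ++ x ∷ []) ≡ x
lastOr-∷ʳ a L x = lastOr-++ a L (x ∷ [])

Ascending-∷ʳ : ∀ {a L x} → Ascending a L → lastOr a L < x → Ascending a (L ++ x ∷ [])
Ascending-∷ʳ []         l<x = l<x ∷ []
Ascending-∷ʳ (a<y ∷ L↑) l<x = a<y ∷ Ascending-∷ʳ L↑ l<x

lastTime≡lastOr : ∀ z zs → lastTime (z ∷ zs) ≡ lastOr z zs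
lastTime≡lastOr z []       = refl
lastTime≡lastOr z (y ∷ ys) = lastTime≡lastOr y ys

Linked⇒Ascending : ∀ {x xs} → Linked _<_ (x ∷ xs) → Ascending x xs
Linked⇒Ascending [-]              = []
Linked⇒Ascending (x<y Linked.∷ l) = x<y ∷ Linked⇒Ascending l

module _ {a : ℕ} where

  Ascending-map-∸ : ∀ {c Z} → a ≤ c → Ascending c Z → Ascending (c ∸ a) (map (_∸ a) Z)
  Ascending-map-∸ a≤c []         = []
  Ascending-map-∸ a≤c (c<z ∷ Z↑) =
    ℕ.∸-monoˡ-< c<z a≤c ∷ Ascending-map-∸ (ℕ.≤-trans a≤c (ℕ.<⇒≤ c<z)) Z↑

  lastOr-map-∸ : ∀ {c Z} → a ≤ c → Ascending c Z → lastOr (c ∸ a) (map (_∸ a) Z) ≡ lastOr c Z ∸ a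
  lastOr-map-∸ a≤c []         = refl
  lastOr-map-∸ a≤c (c<z ∷ Z↑) = lastOr-map-∸ (ℕ.≤-trans a≤c (ℕ.<⇒≤ c<z)) Z↑

  Ascending-map-∸-0 : ∀ {Z} → Ascending a Z → Ascending 0 (map (_∸ a) Z)
  Ascending-map-∸-0 {Z} Z↑ = subst (λ c → Ascending c (map (_∸ a) Z)) (ℕ.n∸n≡0 a) (Ascending-map-∸ ℕ.≤-refl Z↑)

  lastOr-map-∸-0 : ∀ {Z} → Ascending a Z → lastOr 0 (map (_∸ a) Z) ≡ lastOr a Z ∸ a
  lastOr-map-∸-0 {Z} Z↑ = trans (cong (λ c → lastOr c (map (_∸ a) Z)) (sym (ℕ.n∸n≡0 a))) (lastOr-map-∸ ℕ.≤-refl Z↑)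

  map-+-∸ : ∀ {c Z} → a ≤ c → Ascending c Z → map (a ℕ.+_) (map (_∸ a) Z) ≡ Z
  map-+-∸ a≤c []         = refl
  map-+-∸ a≤c (c<z ∷ Z↑) = cong₂ _∷_ (ℕ.m+[n∸m]≡n a≤z) (map-+-∸ a≤z Z↑)
    where a≤z = ℕ.≤-trans a≤c (ℕ.<⇒≤ c<z)

map-≢[] : ∀ {A B : Set} (f : A → B) {xs} → xs ≢ [] → map f xs ≢ []
map-≢[] f {[]}    xs≢[] = ⊥-elim (xs≢[] refl)
map-≢[] f {_ ∷ _} _     = λ ()

data Split (a x : ℕ) : List ℕ → Set where
  all-≤    : ∀ {L} → Ascending a L → lastOr a L ≤ x → Split a x L
  straddle : ∀ {L r R} → Ascending a L → lastOr a L ≤ x → x < r → Ascending r R →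
             Split a x (L ++ r ∷ R)

splitAt : ∀ {a Y} x → a ≤ x → Ascending a Y → Split a x Y
splitAt x a≤x [] = all-≤ [] a≤x
splitAt {Y = y ∷ ys} x a≤x (a<y ∷ Y↑) with y ℕ.≤? x
... | no  y≰x = straddle [] a≤x (ℕ.≰⇒> y≰x) Y↑
... | yes y≤x with splitAt x y≤x Y↑
...   | all-≤ L↑ l≤x             = all-≤ (a<y ∷ L↑) l≤x
...   | straddle L↑ l≤x x<r R↑   = straddle (a<y ∷ L↑) l≤x x<r R↑

-- The enumeration of candidate solutions

∈-subsetsFrom : ∀ n c Y → Ascending c Y → lastOr c Y ≤ c ℕ.+ n → Y ∈ subsetsFrom (suc c) n
∈-subsetsFrom zero    c []      _          _ = here refl
∈-subsetsFrom zero    c (z ∷ Y) (c<z ∷ Y↑) l≤c+0 =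
  ⊥-elim (ℕ.<⇒≱ c<z (ℕ.≤-trans (lastOr-≥ Y↑) (subst (lastOr z Y ≤_) (ℕ.+-identityʳ c) l≤c+0)))
∈-subsetsFrom (suc n) c []      _          _ =
  ∈-++⁺ʳ (map (suc c ∷_) (subsetsFrom (suc (suc c)) n)) (∈-subsetsFrom n (suc c) [] [] (ℕ.m≤m+n (suc c) n))
∈-subsetsFrom (suc n) c (z ∷ Y) (c<z ∷ Y↑) l≤c+n with z ℕ.≟ suc c
... | yes refl = ∈-++⁺ˡ (∈-map⁺ (suc c ∷_) (∈-subsetsFrom n (suc c) Y Y↑ l≤sc+n))
  where l≤sc+n = subst (lastOr z Y ≤_) (ℕ.+-suc c n) l≤c+n
... | no  z≢   = ∈-++⁺ʳ (map (suc c ∷_) (subsetsFrom (suc (suc c)) n))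
                   (∈-subsetsFrom n (suc c) (z ∷ Y) (ℕ.≤∧≢⇒< c<z (z≢ ∘ sym) ∷ Y↑) l≤sc+n)
  where l≤sc+n = subst (lastOr z Y ≤_) (ℕ.+-suc c n) l≤c+n

subsetsFrom-ascending : ∀ n c {Y} → Y ∈ subsetsFrom (suc c) n → Ascending c Y
subsetsFrom-ascending zero    c (here refl) = []
subsetsFrom-ascending (suc n) c Y∈ with ∈-++⁻ (map (suc c ∷_) (subsetsFrom (suc (suc c)) n)) Y∈
... | inj₁ Y∈₁ with ∈-map⁻ (suc c ∷_) Y∈₁
...   | Y′ , Y′∈ , refl = ℕ.n<1+n c ∷ subsetsFrom-ascending n (suc c) Y′∈
subsetsFrom-ascending (suc n) c Y∈ | inj₂ Y∈₂ =
  Ascending-weaken (ℕ.n≤1+n c) (subsetsFrom-ascending n (suc c) Y∈₂)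

applyUpTo-ascending : ∀ (f : ℕ → ℕ) n c → (∀ i → f i ≡ suc (c ℕ.+ i)) →
  Ascending c (applyUpTo f n) × lastOr c (applyUpTo f n) ≡ c ℕ.+ n
applyUpTo-ascending f zero    c f≡ = [] , sym (ℕ.+-identityʳ c)
applyUpTo-ascending f (suc n) c f≡ with applyUpTo-ascending (f ∘ suc) n (suc c) f∘suc≡
  where f∘suc≡ = λ i → trans (f≡ (suc i)) (cong suc (ℕ.+-suc c i))
... | rest↑ , lastRest rewrite f≡ 0 | ℕ.+-identityʳ c =
  ℕ.≤-refl ∷ rest↑ , trans lastRest (sym (ℕ.+-suc c n))

pAt-nonNeg : ∀ {J} → All (0ℚ ≤ℚ_) J → ∀ t → 0ℚ ≤ℚ pAt J t
pAt-nonNeg []           t             = ℚ.≤-refl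
pAt-nonNeg (_ ∷ _)      zero          = ℚ.≤-refl
pAt-nonNeg (0≤q ∷ _)    (suc zero)    = 0≤q
pAt-nonNeg (_ ∷ J≥0)    (suc (suc t)) = pAt-nonNeg J≥0 (suc t)

pAt-beyond : ∀ J {t} → length J < t → pAt J t ≡ 0ℚ
pAt-beyond []       _                 = refl
pAt-beyond (q ∷ qs) {suc (suc t)} (s≤s T<t) = pAt-beyond qs T<t

positive⇒≤length : ∀ J {t} → 0ℚ <ℚ pAt J t → t ≤ length J
positive⇒≤length J {t} p>0 with t ℕ.≤? length J
... | yes t≤T = t≤T
... | no  t≰T = ⊥-elim (ℚ.<-irrefl refl (subst (0ℚ <ℚ_) (pAt-beyond J (ℕ.≰⇒> t≰T)) p>0))

pAt-take : ∀ n J {t} → t ≤ n → pAt (take n J) t ≡ pAt J t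
pAt-take zero    []      z≤n = refl
pAt-take zero    (q ∷ J) z≤n = refl
pAt-take (suc n) []      _   = refl
pAt-take (suc n) (q ∷ J) {zero}          _         = refl
pAt-take (suc n) (q ∷ J) {suc zero}      _         = refl
pAt-take (suc n) (q ∷ J) {suc (suc t)}   (s≤s t<n) = pAt-take n J t<n

pAt-drop : ∀ a J {t} → 0 < t → pAt (drop a J) t ≡ pAt J (a ℕ.+ t)
pAt-drop zero    J       _ = refl
pAt-drop (suc a) []      _ = refl
pAt-drop (suc a) (q ∷ J) {suc t} _ = begin
    pAt (drop a J) (suc t)              ≡⟨ pAt-drop a J (s≤s z≤n) ⟩
    pAt J (a ℕ.+ suc t)                 ≡⟨ cong (pAt J) (ℕ.+-suc a t) ⟩
    pAt (q ∷ J) (suc (suc (a ℕ.+ t)))   ≡⟨ cong (pAt (q ∷ J) ∘ suc) (ℕ.+-suc a t) ⟨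
    pAt (q ∷ J) (suc a ℕ.+ suc t)       ∎
  where open ≡-Reasoning

delayCost : Instance → ℕ → ℕ → ℚ
delayCost J x t = pAt J t ℚ.* ℕtoℚ (x ∸ t)

module _ {J : Instance} (J≥0 : All (0ℚ ≤ℚ_) J) where

  delayCost-nonNeg : ∀ x t → 0ℚ ≤ℚ delayCost J x t
  delayCost-nonNeg x t = ℚ.nonNegative⁻¹ _ {{ℚ.nonNeg*nonNeg⇒nonNeg
    (pAt J t) {{ℚ.nonNegative (pAt-nonNeg J≥0 t)}} (ℕtoℚ (x ∸ t)) {{ℚ.normalize-nonNeg (x ∸ t) 1}}}}

  delayCost-mono-≤ : ∀ {x y} t → x ≤ y → delayCost J x t ≤ℚ delayCost J y t
  delayCost-mono-≤ t x≤y = ℚ.*-monoˡ-≤-nonNeg (pAt J t) {{ℚ.nonNegative (pAt-nonNeg J≥0 t)}}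
    (ℕtoℚ-mono-≤ (ℕ.∸-monoˡ-≤ t x≤y))

delayCost-nonPos : ∀ J x t → ¬ (0ℚ <ℚ pAt J t) → delayCost J x t ≤ℚ 0ℚ
delayCost-nonPos J x t p≯0 = subst (delayCost J x t ≤ℚ_) (ℚ.*-zeroˡ (ℕtoℚ (x ∸ t)))
  (ℚ.*-monoʳ-≤-nonNeg (ℕtoℚ (x ∸ t)) {{ℚ.normalize-nonNeg (x ∸ t) 1}} (ℚ.≮⇒≥ p≯0))

waiting-++ : ∀ J a L R → waiting J a (L ++ R) ≡ waiting J a L + waiting J (lastOr a L) R
waiting-++ J a []      R = sym (ℚ.+-identityˡ _)
waiting-++ J a (y ∷ L) R = trans (cong (sumRange (delayCost J y) a y +_) (waiting-++ J y L R))
  (sym (ℚ.+-assoc (sumRange (delayCost J y) a y) (waiting J y L) (waiting J (lastOr y L) R)))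

waiting-nonNeg : ∀ {J} → All (0ℚ ≤ℚ_) J → ∀ a Y → 0ℚ ≤ℚ waiting J a Y
waiting-nonNeg J≥0 a []      = ℚ.≤-refl
waiting-nonNeg J≥0 a (y ∷ Y) =
  ℚ.+-mono-≤ (sumRange-nonNeg a y (λ t _ _ → delayCost-nonNeg J≥0 y t)) (waiting-nonNeg J≥0 y Y)

waiting-∷ʳ-+ : ∀ J a L x R → waiting J a (L ++ x ∷ []) + waiting J x R ≡ waiting J a (L ++ x ∷ R)
waiting-∷ʳ-+ J a L x R = begin
    waiting J a (L ++ x ∷ []) + waiting J x R
      ≡⟨ cong (λ c → waiting J a (L ++ x ∷ []) + waiting J c R) (lastOr-∷ʳ a L x) ⟨
    waiting J a (L ++ x ∷ []) + waiting J (lastOr a (L ++ x ∷ [])) R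
      ≡⟨ waiting-++ J a (L ++ x ∷ []) R ⟨
    waiting J a ((L ++ x ∷ []) ++ R)
      ≡⟨ cong (waiting J a) (List.++-assoc L (x ∷ []) R) ⟩
    waiting J a (L ++ x ∷ R)
      ∎
  where open ≡-Reasoning

waiting-take : ∀ n J {c Z} → Ascending c Z → lastOr c Z ≤ n → waiting (take n J) c Z ≡ waiting J c Z
waiting-take n J []                   _    = refl
waiting-take n J {c} {z ∷ _} (c<z ∷ Z↑) l≤n = cong₂ _+_
  (sumRange-cong c z (λ t _ t≤z → cong (ℚ._* ℕtoℚ (z ∸ t)) (pAt-take n J (ℕ.≤-trans t≤z z≤l))))
  (waiting-take n J Z↑ l≤n)
  where z≤l = ℕ.≤-trans (lastOr-≥ Z↑) l≤n

waiting-drop : ∀ a J c Z → waiting (drop a J) c Z ≡ waiting J (a ℕ.+ c) (map (a ℕ.+_) Z)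
waiting-drop a J c []      = refl
waiting-drop a J c (z ∷ Z) = cong₂ _+_ shifted (waiting-drop a J z Z)
  where
  shifted : sumRange (delayCost (drop a J) z) c z
          ≡ sumRange (delayCost J (a ℕ.+ z)) (a ℕ.+ c) (a ℕ.+ z)
  shifted = trans
    (sumRange-cong c z (λ t c<t _ → cong₂ ℚ._*_ (pAt-drop a J (ℕ.≤-<-trans z≤n c<t))
                                               (cong ℕtoℚ (sym (ℕ.[m+n]∸[m+o]≡n∸o a z t)))))
    (sym (sumRange-shift (delayCost J (a ℕ.+ z)) a c z))

-- Feasibility and the optimum

FeasibleFrom : Instance → ℕ → Solution → Set
FeasibleFrom J a Y = ∀ t → a < t → 0ℚ <ℚ pAt J t → t ≤ lastOr a Y

notPositiveᵇ : ℚ → Bool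
notPositiveᵇ q = not ⌊ 0ℚ ℚ.<? q ⌋

T-notPositiveᵇ⁺ : ∀ {q} → ¬ (0ℚ <ℚ q) → T (notPositiveᵇ q)
T-notPositiveᵇ⁺ {q} q≯0 with 0ℚ ℚ.<? q
... | yes q>0 = q≯0 q>0
... | no  _   = _

T-notPositiveᵇ⁻ : ∀ {q} → T (notPositiveᵇ q) → ¬ (0ℚ <ℚ q)
T-notPositiveᵇ⁻ {q} ok with 0ℚ ℚ.<? q
... | no q≯0 = q≯0

module _ (P : ℚ → Bool) where

  T-allᵇ-drop⁺ : ∀ J n → (∀ t → n < t → t ≤ length J → T (P (pAt J t))) → T (allᵇ P (drop n J))
  T-allᵇ-drop⁺ []       zero    _  = _
  T-allᵇ-drop⁺ []       (suc n) _  = _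
  T-allᵇ-drop⁺ (q ∷ qs) zero    Pt = Equivalence.from T-∧
    (Pt 1 (s≤s z≤n) (s≤s z≤n) , T-allᵇ-drop⁺ qs 0 λ { (suc t) _ t≤ → Pt (suc (suc t)) (s≤s z≤n) (s≤s t≤) })
  T-allᵇ-drop⁺ (q ∷ qs) (suc n) Pt =
    T-allᵇ-drop⁺ qs n λ { (suc t) n<t t≤ → Pt (suc (suc t)) (s≤s n<t) (s≤s t≤) }

  T-allᵇ-drop⁻ : ∀ J n → T (allᵇ P (drop n J)) → ∀ t → n < t → t ≤ length J → T (P (pAt J t))
  T-allᵇ-drop⁻ (q ∷ qs) zero    ok (suc zero)    _         _         = proj₁ (Equivalence.to T-∧ ok)
  T-allᵇ-drop⁻ (q ∷ qs) zero    ok (suc (suc t)) _         (s≤s t≤) =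
    T-allᵇ-drop⁻ qs 0 (proj₂ (Equivalence.to T-∧ ok)) (suc t) (s≤s z≤n) t≤
  T-allᵇ-drop⁻ (q ∷ qs) (suc n) ok (suc (suc t)) (s≤s n<t) (s≤s t≤) = T-allᵇ-drop⁻ qs n ok (suc t) n<t t≤

feasibleᵇ-sound : ∀ J Y → T (feasibleᵇ J Y) → Y ≢ [] × FeasibleFrom J 0 Y
feasibleᵇ-sound J (z ∷ zs) ok = (λ ()) , feasible
  where
  feasible : FeasibleFrom J 0 (z ∷ zs)
  feasible t _ p>0 with t ℕ.≤? lastTime (z ∷ zs)
  ... | yes t≤l = subst (t ≤_) (lastTime≡lastOr z zs) t≤l
  ... | no  t≰l = ⊥-elim (T-notPositiveᵇ⁻
          (T-allᵇ-drop⁻ notPositiveᵇ J _ ok t (ℕ.≰⇒> t≰l) (positive⇒≤length J p>0)) p>0)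

feasibleᵇ-complete : ∀ J Y → Y ≢ [] → FeasibleFrom J 0 Y → T (feasibleᵇ J Y)
feasibleᵇ-complete J []       Y≢[] _        = ⊥-elim (Y≢[] refl)
feasibleᵇ-complete J (z ∷ zs) _    feasible = T-allᵇ-drop⁺ notPositiveᵇ J (lastTime (z ∷ zs))
  (λ t l<t _ → T-notPositiveᵇ⁺ (λ p>0 →
     ℕ.<⇒≱ l<t (subst (t ≤_) (sym (lastTime≡lastOr z zs)) (feasible t (ℕ.≤-<-trans z≤n l<t) p>0))))

foldr-⊓-≤ : ∀ {A : Set} (f : A → ℚ) e {xs y} → y ∈ xs → foldr ℚ._⊓_ e (map f xs) ≤ℚ f y
foldr-⊓-≤ f e {xs} y∈xs =
  List.foldr-preservesᵒ (λ p q → [ ℚ.p≤q⇒p⊓r≤q q , ℚ.p≤q⇒r⊓p≤q p ]) e (map f xs)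
    (inj₂ (Any.map (ℚ.≤-reflexive ∘ sym) (∈-map⁺ f y∈xs)))

foldr-⊓-sel : ∀ {A : Set} (f : A → ℚ) e xs →
  foldr ℚ._⊓_ e (map f xs) ≡ e ⊎ ∃[ y ] y ∈ xs × foldr ℚ._⊓_ e (map f xs) ≡ f y
foldr-⊓-sel f e xs with foldr-selective ℚ.⊓-sel e (map f xs)
... | inj₁ ≡e  = inj₁ ≡e
... | inj₂ ∈fs = let y , y∈xs , ≡fy = ∈-map⁻ f ∈fs in inj₂ (y , y∈xs , ≡fy)

fullSolution-feasible : ∀ J → Ascending 0 (fullSolution J) × FeasibleFrom J 0 (fullSolution J)
fullSolution-feasible J with applyUpTo-ascending suc (length J) 0 (λ _ → refl)
... | full↑ , last≡T = full↑ , λ t _ p>0 → subst (t ≤_) (sym last≡T) (positive⇒≤length J p>0)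

module _ (d : ℚ) .{{_ : Positive d}} where

  OPT-≤-cost : ∀ J Z → Ascending 0 Z → lastOr 0 Z ≤ length J → Z ≢ [] → FeasibleFrom J 0 Z →
    OPT d J ≤ℚ cost d J Z
  OPT-≤-cost J Z Z↑ l≤T Z≢[] feasible = foldr-⊓-≤ (cost d J) (cost d J (fullSolution J))
    (∈-filter⁺ (T? ∘ feasibleᵇ J) (∈-subsetsFrom (length J) 0 Z Z↑ l≤T) (feasibleᵇ-complete J Z Z≢[] feasible))

  OPT-attained : ∀ J → 0 < length J →
    ∃[ Y ] Ascending 0 Y × Y ≢ [] × FeasibleFrom J 0 Y × OPT d J ≡ cost d J Y
  OPT-attained J T>0
    with foldr-⊓-sel (cost d J) (cost d J (fullSolution J)) (filterᵇ (feasibleᵇ J) (subsetsFrom 1 (length J)))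
  ... | inj₁ ≡full =
    let full↑ , full-feasible = fullSolution-feasible J
    in fullSolution J , full↑ , full≢[] T>0 , full-feasible , ≡full
    where
    full≢[] : ∀ {n} → 0 < n → applyUpTo suc n ≢ []
    full≢[] (s≤s _) ()
  ... | inj₂ (Y , Y∈ , ≡Y) =
    let Y∈subsets , ok = ∈-filter⁻ (T? ∘ feasibleᵇ J) Y∈
        Y≢[] , feasible = feasibleᵇ-sound J Y ok
    in Y , subsetsFrom-ascending (length J) 0 Y∈subsets , Y≢[] , feasible , ≡Y

-- Cutting an optimal solution along the segments

module _ (d : ℚ) .{{_ : Positive d}} (I : Instance) (I≥0 : All (0ℚ ≤ℚ_) I) where

  infix 8 _/d
  _/d : ℚ → ℚ
  w /d = (w ÷ d) {{ℚ.pos⇒nonZero d}}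

  1/d : ℚ
  1/d = (ℚ.1/ d) {{ℚ.pos⇒nonZero d}}

  /d-mono-≤ : ∀ {u v} → u ≤ℚ v → u /d ≤ℚ v /d
  /d-mono-≤ = ℚ.*-monoʳ-≤-nonNeg 1/d {{ℚ.pos⇒nonNeg 1/d {{ℚ.1/pos⇒pos d}}}}

  -- The cost of n acknowledgments with total waiting w; cost d J Z is price (length Z) (waiting J 0 Z).
  price : ℕ → ℚ → ℚ
  price n w = ℕtoℚ n + w /d

  price-+ : ∀ m n u v → price m u + price n v ≡ price (m ℕ.+ n) (u + v)
  price-+ m n u v = begin
      (ℕtoℚ m + u /d) + (ℕtoℚ n + v /d)   ≡⟨ solve 4 (λ m u n v → (m :+ u) :+ (n :+ v) := (m :+ n) :+ (u :+ v))
                                                     refl (ℕtoℚ m) (u /d) (ℕtoℚ n) (v /d) ⟩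
      (ℕtoℚ m + ℕtoℚ n) + (u /d + v /d)   ≡⟨ cong₂ _+_ (ℕtoℚ-+ m n) (ℚ.*-distribʳ-+ 1/d u v) ⟨
      price (m ℕ.+ n) (u + v)             ∎
    where
    open ≡-Reasoning
    open +-*-Solver

  price-+ˡ : ∀ m n w → price (m ℕ.+ n) w ≡ ℕtoℚ m + price n w
  price-+ˡ m n w = trans (cong (_+ w /d) (ℕtoℚ-+ m n)) (ℚ.+-assoc (ℕtoℚ m) (ℕtoℚ n) (w /d))

  1+price+ℕtoℚ : ∀ m n w → 1ℚ + (price m w + ℕtoℚ n) ≡ price (suc n ℕ.+ m) w
  1+price+ℕtoℚ m n w = begin
      1ℚ + ((ℕtoℚ m + w /d) + ℕtoℚ n)
        ≡⟨ solve 3 (λ m w n → con 1ℚ :+ ((m :+ w) :+ n) := ((con 1ℚ :+ n) :+ m) :+ w) refl (ℕtoℚ m) (w /d) (ℕtoℚ n) ⟩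
      ((1ℚ + ℕtoℚ n) + ℕtoℚ m) + w /d
        ≡⟨ cong (_+ w /d) (trans (ℕtoℚ-+ (suc n) m) (cong (_+ ℕtoℚ m) (ℕtoℚ-+ 1 n))) ⟨
      price (suc n ℕ.+ m) w
        ∎
    where
    open ≡-Reasoning
    open +-*-Solver

  price-mono-≤ : ∀ {m n u v} → m ≤ n → u ≤ℚ v → price m u ≤ℚ price n v
  price-mono-≤ m≤n u≤v = ℚ.+-mono-≤ (ℕtoℚ-mono-≤ m≤n) (/d-mono-≤ u≤v)

  price-0 : ∀ n → price n 0ℚ ≡ ℕtoℚ n
  price-0 n = trans (cong (ℕtoℚ n +_) (ℚ.*-zeroˡ 1/d)) (ℚ.+-identityʳ (ℕtoℚ n))

  segment : ℕ → ℕ → Instance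
  segment a x = take (x ∸ a) (drop a I)

  length-segment : ∀ {a x} → x ≤ length I → length (segment a x) ≡ x ∸ a
  length-segment {a} {x} x≤T = trans (List.length-take (x ∸ a) (drop a I))
    (trans (cong ((x ∸ a) ℕ.⊓_) (List.length-drop a I)) (ℕ.m≤n⇒m⊓n≡m (ℕ.∸-monoˡ-≤ a x≤T)))

  waiting-segment : ∀ {a x L} → Ascending a L → lastOr a L ≤ x →
    waiting (segment a x) 0 (map (_∸ a) L) ≡ waiting I a L
  waiting-segment {a} {x} {L} L↑ l≤x = begin
      waiting (segment a x) 0 (map (_∸ a) L)            ≡⟨ waiting-take (x ∸ a) (drop a I) (Ascending-map-∸-0 L↑) l′≤x∸a ⟩
      waiting (drop a I) 0 (map (_∸ a) L)               ≡⟨ waiting-drop a I 0 (map (_∸ a) L) ⟩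
      waiting I (a ℕ.+ 0) (map (a ℕ.+_) (map (_∸ a) L)) ≡⟨ cong₂ (waiting I) (ℕ.+-identityʳ a) (map-+-∸ ℕ.≤-refl L↑) ⟩
      waiting I a L                                     ∎
    where
    open ≡-Reasoning
    l′≤x∸a = subst (_≤ x ∸ a) (sym (lastOr-map-∸-0 L↑)) (ℕ.∸-monoˡ-≤ a l≤x)

  segment-feasible : ∀ {a x L} → x ≤ length I → Ascending a L → lastOr a L ≤ x →
    (∀ t → lastOr a L < t → t ≤ x → ¬ (0ℚ <ℚ pAt I t)) →
    FeasibleFrom (segment a x) 0 (map (_∸ a) L)
  segment-feasible {a} {x} {L} x≤T L↑ l≤x quiet t 0<t p>0 with lastOr a L ℕ.<? a ℕ.+ t
  ... | yes l<a+t = ⊥-elim (quiet (a ℕ.+ t) l<a+t a+t≤x (subst (0ℚ <ℚ_) pAt≡ p>0))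
    where
    t≤x∸a = subst (t ≤_) (length-segment {a} x≤T) (positive⇒≤length (segment a x) p>0)
    a+t≤x = ℕ.≤-trans (ℕ.+-monoʳ-≤ a t≤x∸a) (ℕ.≤-reflexive (ℕ.m+[n∸m]≡n (ℕ.≤-trans (lastOr-≥ L↑) l≤x)))
    pAt≡ : pAt (segment a x) t ≡ pAt I (a ℕ.+ t)
    pAt≡ = trans (pAt-take (x ∸ a) (drop a I) t≤x∸a) (pAt-drop a I 0<t)
  ... | no  l≮a+t = subst (t ≤_) (sym (lastOr-map-∸-0 L↑)) (ℕ.m+n≤o⇒m≤o∸n t t+a≤l)
    where t+a≤l = subst (_≤ lastOr a L) (ℕ.+-comm a t) (ℕ.≮⇒≥ l≮a+t)

  OPT-segment-≤ : ∀ {a x L} → x ≤ length I → Ascending a L → lastOr a L ≤ x → L ≢ [] →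
    (∀ t → lastOr a L < t → t ≤ x → ¬ (0ℚ <ℚ pAt I t)) →
    OPT d (segment a x) ≤ℚ price (length L) (waiting I a L)
  OPT-segment-≤ {a} {x} {L} x≤T L↑ l≤x L≢[] quiet = begin
      OPT d (segment a x)
        ≤⟨ OPT-≤-cost d (segment a x) (map (_∸ a) L) (Ascending-map-∸-0 L↑) l′≤T (map-≢[] (_∸ a) L≢[])
                      (segment-feasible x≤T L↑ l≤x quiet) ⟩
      price (length (map (_∸ a) L)) (waiting (segment a x) 0 (map (_∸ a) L))
        ≡⟨ cong₂ price (List.length-map (_∸ a) L) (waiting-segment L↑ l≤x) ⟩
      price (length L) (waiting I a L)
        ∎
    where
    open ℚ.≤-Reasoning
    l′≤T = subst₂ _≤_ (sym (lastOr-map-∸-0 L↑)) (sym (length-segment {a} x≤T)) (ℕ.∸-monoˡ-≤ a l≤x)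

  OPT-segment-≤-closing : ∀ {a x L} → a < x → x ≤ length I → Ascending a L → lastOr a L ≤ x →
    OPT d (segment a x) ≤ℚ price (length L ℕ.+ 1) (waiting I a (L ++ x ∷ []))
  OPT-segment-≤-closing {a} {x} {L} a<x x≤T L↑ l≤x with ℕ.m≤n⇒m<n∨m≡n l≤x
  ... | inj₁ l<x = begin
      OPT d (segment a x)
        ≤⟨ OPT-segment-≤ x≤T (Ascending-∷ʳ L↑ l<x) (ℕ.≤-reflexive (lastOr-∷ʳ a L x)) (∷ʳ-≢[] L) quiet ⟩
      price (length (L ++ x ∷ [])) (waiting I a (L ++ x ∷ []))
        ≡⟨ cong (λ n → price n (waiting I a (L ++ x ∷ []))) (List.length-++ L) ⟩
      price (length L ℕ.+ 1) (waiting I a (L ++ x ∷ []))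
        ∎
    where
    open ℚ.≤-Reasoning
    ∷ʳ-≢[] : ∀ L → L ++ x ∷ [] ≢ []
    ∷ʳ-≢[] []      ()
    ∷ʳ-≢[] (_ ∷ _) ()
    quiet : ∀ t → lastOr a (L ++ x ∷ []) < t → t ≤ x → ¬ (0ℚ <ℚ pAt I t)
    quiet t x<t t≤x = ⊥-elim (ℕ.<⇒≱ (subst (_< t) (lastOr-∷ʳ a L x) x<t) t≤x)
  ... | inj₂ l≡x = begin
      OPT d (segment a x)                                  ≤⟨ OPT-segment-≤ x≤T L↑ l≤x L≢[] quiet ⟩
      price (length L) (waiting I a L)                     ≤⟨ price-mono-≤ (ℕ.m≤m+n (length L) 1) w≤ ⟩
      price (length L ℕ.+ 1) (waiting I a (L ++ x ∷ []))   ∎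
    where
    open ℚ.≤-Reasoning
    L≢[] : L ≢ []
    L≢[] refl = ℕ.<⇒≢ a<x l≡x
    quiet : ∀ t → lastOr a L < t → t ≤ x → ¬ (0ℚ <ℚ pAt I t)
    quiet t l<t t≤x = ⊥-elim (ℕ.<⇒≱ (subst (_< t) l≡x l<t) t≤x)
    w≤ : waiting I a L ≤ℚ waiting I a (L ++ x ∷ [])
    w≤ = begin
      waiting I a L
        ≡⟨ ℚ.+-identityʳ (waiting I a L) ⟨
      waiting I a L + 0ℚ
        ≤⟨ ℚ.+-monoʳ-≤ (waiting I a L) (waiting-nonNeg I≥0 (lastOr a L) (x ∷ [])) ⟩
      waiting I a L + waiting I (lastOr a L) (x ∷ [])
        ≡⟨ waiting-++ I a L (x ∷ []) ⟨
      waiting I a (L ++ x ∷ [])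
        ∎

  waiting-insert-≤ : ∀ a L {x r} R → lastOr a L ≤ x → x ≤ r →
    waiting I a (L ++ x ∷ r ∷ R) ≤ℚ waiting I a (L ++ r ∷ R)
  waiting-insert-≤ a L {x} {r} R l≤x x≤r = begin
      waiting I a (L ++ x ∷ r ∷ R)
        ≡⟨ waiting-++ I a L (x ∷ r ∷ R) ⟩
      waiting I a L + (Sx + (Sr + waiting I r R))
        ≡⟨ cong (waiting I a L +_) (ℚ.+-assoc Sx Sr (waiting I r R)) ⟨
      waiting I a L + ((Sx + Sr) + waiting I r R)
        ≤⟨ ℚ.+-monoʳ-≤ (waiting I a L) (ℚ.+-monoˡ-≤ (waiting I r R) Sx+Sr≤) ⟩
      waiting I a L + (sumRange (delayCost I r) l r + waiting I r R)
        ≡⟨ waiting-++ I a L (r ∷ R) ⟨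
      waiting I a (L ++ r ∷ R)
        ∎
    where
    open ℚ.≤-Reasoning
    l = lastOr a L
    Sx = sumRange (delayCost I x) l x
    Sr = sumRange (delayCost I r) x r
    Sx+Sr≤ : Sx + Sr ≤ℚ sumRange (delayCost I r) l r
    Sx+Sr≤ = begin
      Sx + Sr
        ≤⟨ ℚ.+-monoˡ-≤ Sr (sumRange-mono-≤ l x (λ t _ _ → delayCost-mono-≤ I≥0 t x≤r)) ⟩
      sumRange (delayCost I r) l x + Sr
        ≡⟨ sumRange-split (delayCost I r) l≤x x≤r ⟨
      sumRange (delayCost I r) l r
        ∎

  Σsegments : ℕ → Solution → ℚ
  Σsegments a X = sumℚ (map (OPT d) (segments I a X))

  Σsegments-≤-length : ∀ {a X} → Ascending a X → All (_≤ length I) X → FeasibleFrom I a [] →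
    Σsegments a X ≤ℚ ℕtoℚ (length X)
  Σsegments-≤-length []                           []           _     = ℚ.≤-refl
  Σsegments-≤-length {a} {x ∷ xs} (a<x ∷ X↑) (x≤T ∷ X≤T) quiet = begin
      OPT d (segment a x) + Σsegments x xs   ≤⟨ ℚ.+-mono-≤ segment≤1 (Σsegments-≤-length X↑ X≤T quiet′) ⟩
      1ℚ + ℕtoℚ (length xs)                  ≡⟨ ℕtoℚ-+ 1 (length xs) ⟨
      ℕtoℚ (length (x ∷ xs))                 ∎
    where
    open ℚ.≤-Reasoning
    quiet′ : FeasibleFrom I x []
    quiet′ t x<t p>0 = ℕ.≤-trans (quiet t (ℕ.<-trans a<x x<t) p>0) (ℕ.<⇒≤ a<x)
    waiting≤0 : waiting I a (x ∷ []) ≤ℚ 0ℚ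
    waiting≤0 = subst (_≤ℚ 0ℚ) (sym (ℚ.+-identityʳ _)) (sumRange-nonPos a x (λ t a<t _ →
      delayCost-nonPos I x t (λ p>0 → ℕ.<⇒≱ a<t (quiet t a<t p>0))))
    segment≤1 : OPT d (segment a x) ≤ℚ 1ℚ
    segment≤1 = begin
      OPT d (segment a x)              ≤⟨ OPT-segment-≤-closing a<x x≤T [] (ℕ.<⇒≤ a<x) ⟩
      price 1 (waiting I a (x ∷ []))   ≤⟨ price-mono-≤ (ℕ.≤-refl {1}) waiting≤0 ⟩
      price 1 0ℚ                       ≡⟨ price-0 1 ⟩
      1ℚ                               ∎

  Σsegments-≤ : ∀ {a X Y} → Ascending a X → All (_≤ length I) X →
    Ascending a Y → Y ≢ [] → FeasibleFrom I a Y →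
    1ℚ + Σsegments a X ≤ℚ price (length X ℕ.+ length Y) (waiting I a Y)
  Σsegments-≤ {a} {[]} {Y} [] [] _ Y≢[] _ = begin
      1ℚ + 0ℚ                ≡⟨ price-0 1 ⟨
      price 1 0ℚ             ≤⟨ price-mono-≤ (1≤length Y≢[]) (waiting-nonNeg I≥0 a Y) ⟩
      price (length Y) (waiting I a Y) ∎
    where
    open ℚ.≤-Reasoning
    1≤length : ∀ {Y : List ℕ} → Y ≢ [] → 1 ≤ length Y
    1≤length {[]}    Y≢[] = ⊥-elim (Y≢[] refl)
    1≤length {_ ∷ _} _    = s≤s z≤n
  Σsegments-≤ {a} {x ∷ xs} (a<x ∷ X↑) (x≤T ∷ X≤T) Y↑ Y≢[] feasible
    with splitAt x (ℕ.<⇒≤ a<x) Y↑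
  ... | all-≤ [] _ = ⊥-elim (Y≢[] refl)
  ... | all-≤ {L} L↑@(_ ∷ _) l≤x = begin
      1ℚ + (OPT d (segment a x) + Σsegments x xs)
        ≤⟨ ℚ.+-monoʳ-≤ 1ℚ (ℚ.+-mono-≤ (OPT-segment-≤ x≤T L↑ l≤x (λ ()) quiet)
                                     (Σsegments-≤-length X↑ X≤T quiet′)) ⟩
      1ℚ + (price (length L) (waiting I a L) + ℕtoℚ (length xs))
        ≡⟨ 1+price+ℕtoℚ (length L) (length xs) (waiting I a L) ⟩
      price (length (x ∷ xs) ℕ.+ length L) (waiting I a L) ∎
    where
    open ℚ.≤-Reasoning
    quiet : ∀ t → lastOr a L < t → t ≤ x → ¬ (0ℚ <ℚ pAt I t)
    quiet t l<t _ p>0 = ℕ.<⇒≱ l<t (feasible t (ℕ.≤-<-trans (lastOr-≥ L↑) l<t) p>0)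
    quiet′ : FeasibleFrom I x []
    quiet′ t x<t p>0 = ℕ.≤-trans (feasible t (ℕ.<-trans a<x x<t) p>0) l≤x
  ... | straddle {L} {r} {R} L↑ l≤x x<r R↑ = begin
      1ℚ + (OPT d (segment a x) + Σsegments x xs)
        ≡⟨ solve 3 (λ u p q → u :+ (p :+ q) := p :+ (u :+ q)) refl 1ℚ (OPT d (segment a x)) (Σsegments x xs) ⟩
      OPT d (segment a x) + (1ℚ + Σsegments x xs)
        ≤⟨ ℚ.+-mono-≤ (OPT-segment-≤-closing a<x x≤T L↑ l≤x)
                      (Σsegments-≤ X↑ X≤T (x<r ∷ R↑) (λ ()) feasible′) ⟩
      price nL (waiting I a (L ++ x ∷ [])) + price nR (waiting I x (r ∷ R))
        ≡⟨ price-+ nL nR (waiting I a (L ++ x ∷ [])) (waiting I x (r ∷ R)) ⟩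
      price (nL ℕ.+ nR) (waiting I a (L ++ x ∷ []) + waiting I x (r ∷ R))
        ≡⟨ cong₂ price count (waiting-∷ʳ-+ I a L x (r ∷ R)) ⟩
      price n (waiting I a (L ++ x ∷ r ∷ R))
        ≤⟨ price-mono-≤ (ℕ.≤-refl {n}) (waiting-insert-≤ a L R l≤x (ℕ.<⇒≤ x<r)) ⟩
      price n (waiting I a (L ++ r ∷ R))
        ∎
    where
    open ℚ.≤-Reasoning
    open +-*-Solver
    nL = length L ℕ.+ 1
    nR = length xs ℕ.+ length (r ∷ R)
    n = length (x ∷ xs) ℕ.+ length (L ++ r ∷ R)
    feasible′ : FeasibleFrom I x (r ∷ R)
    feasible′ t x<t p>0 = subst (t ≤_) (lastOr-++ a L (r ∷ R)) (feasible t (ℕ.<-trans a<x x<t) p>0)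
    count : nL ℕ.+ nR ≡ n
    count = trans (lengths (length L) (length xs) (length R)) (cong (suc (length xs) ℕ.+_) (sym (List.length-++ L)))
      where
      lengths : ∀ l k m → (l ℕ.+ 1) ℕ.+ (k ℕ.+ suc m) ≡ suc k ℕ.+ (l ℕ.+ suc m)
      lengths = solve-∀

mainTheorem9 : (d : ℚ) → .{{_ : Positive d}} → (I : Instance) → All (0ℚ ≤ℚ_) I →
    (X : Solution) →
    Linked _<_ X → All (λ x → 1 ≤ x × x ≤ length I) X → X ≢ [] →
    (∀ t → 1 ≤ t → t ≤ length I → 0ℚ <ℚ pAt I t → t ≤ lastTime X) →
    sumℚ (map (OPT d) (segments I 0 X)) ≤ℚ (ℕtoℚ (length X) - 1ℚ) + OPT d I
mainTheorem9 d I I≥0 []       _        _                          X≢[] _ = ⊥-elim (X≢[] refl)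
mainTheorem9 d I I≥0 X@(x ∷ _) X-linked X-range@((0<x , x≤T) ∷ _) _    _
  with OPT-attained d I (ℕ.≤-trans 0<x x≤T)
... | Y , Y↑ , Y≢[] , Y-feasible , OPT≡cost =
  1+p≤q+r⇒p≤q-1+r (Σsegments d I I≥0 0 X) (ℕtoℚ (length X)) (OPT d I) (begin
    1ℚ + Σsegments d I I≥0 0 X
      ≤⟨ Σsegments-≤ d I I≥0 (0<x ∷ Linked⇒Ascending X-linked) (All.map proj₂ X-range) Y↑ Y≢[] Y-feasible ⟩
    price d I I≥0 (length X ℕ.+ length Y) (waiting I 0 Y)
      ≡⟨ price-+ˡ d I I≥0 (length X) (length Y) (waiting I 0 Y) ⟩
    ℕtoℚ (length X) + cost d I Y
      ≡⟨ cong (ℕtoℚ (length X) +_) OPT≡cost ⟨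
    ℕtoℚ (length X) + OPT d I
      ∎)
  where open ℚ.≤-Reasoning
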